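{- Closure under unknown information is decidable on languages accepted by c-automata: there is an algorithm that, given a c-automaton $\mathcal{A}$, decides whether $\mathbf{L}(\mathcal{A})$ is CUI.
   Context: Fix disjoint sets $\mathfrak{P}$ (participants) and $\mathfrak{M}$ (messages); interactions $\Sigma_{int}=\{A\to B{:}m\mid A\neq B\}$. An FSA $\langle\mathcal{S},q_0,\mathcal{L},\to\rangle$ has finitely many states, initial state, finitely many labels and transitions; all states are accepting and its language $\mathbf{L}$ consists of finite words labelling finite paths from $q_0$ and infinite words labelling infinite paths from $q_0$. A c-automaton is a deterministic FSA labelled in $\Sigma_{int}$. Projection: $(A\to B{:}m){\upharpoonright}_A=AB!m$, $(A\to B{:}m){\upharpoonright}_B=AB?m$, $\varepsilon$ for other participants, extended homomorphically to words. A set $\mathcal{L}$ of interaction words is CUI (closed under unknown information) if for all finite words $w_1\cdot\alpha,w_2\cdot\alpha\in\mathcal{L}$ with the same last interaction $\alpha=A\to B{:}m$ and all $w\in\mathcal{L}$ with $w{\upharpoonright}_A=w_1{\upharpoonright}_A$ and $w{\upharpoonright}_B=w_2{\upharpoonright}_B$, we have $w\cdot\alpha\in\mathcal{L}$. -}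

module Defs where

open import Data.Nat using (ℕ)
open import Data.Fin using (Fin)
open import Data.List using (List; []; _∷_; _++_; [_])
open import Data.List.Membership.Propositional using (_∈_)
open import Data.Product using (_×_; _,_)
open import Relation.Binary.PropositionalEquality using (_≡_; _≢_)
open import Relation.Binary.Definitions using (DecidableEquality)
open import Relation.Nullary using (yes; no)

record Interaction (P M : Set) : Set where
  constructor _⟶_∶_⟨_⟩
  field
    sender   : P
    receiver : P
    msg      : M
    .distinct : sender ≢ receiver
open Interaction public

data Action (P M : Set) : Set where
  send : P → P → M → Action P M
  recv : P → P → M → Action P M

module _ {P M : Set} (_≟_ : DecidableEquality P) where

  projI : P → Interaction P M → List (Action P M)
  projI C α with sender α ≟ C
  ... | yes _ = send (sender α) (receiver α) (msg α) ∷ []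
  ... | no _ with receiver α ≟ C
  ...   | yes _ = recv (sender α) (receiver α) (msg α) ∷ []
  ...   | no _ = []

  proj : P → List (Interaction P M) → List (Action P M)
  proj C []      = []
  proj C (α ∷ w) = projI C α ++ proj C w

  CUI : (List (Interaction P M) → Set) → Set
  CUI L = ∀ (w₁ w₂ w : List (Interaction P M)) (α : Interaction P M) →
          L (w₁ ++ [ α ]) → L (w₂ ++ [ α ]) → L w →
          proj (sender α) w ≡ proj (sender α) w₁ →
          proj (receiver α) w ≡ proj (receiver α) w₂ →
          L (w ++ [ α ])

-- A finite-state automaton labelled in interactions: states Fin n,
-- initial state, finite list of transitions (source, label, target).
-- (The label set is the finite set of labels occurring in transitions.)
record FSA (P M : Set) : Set where
  field
    n      : ℕ
    q₀     : Fin n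
    trans  : List (Fin n × Interaction P M × Fin n)
open FSA public

Deterministic : {P M : Set} → FSA P M → Set
Deterministic A = ∀ {q α q₁ q₂} → (q , α , q₁) ∈ trans A → (q , α , q₂) ∈ trans A → q₁ ≡ q₂

record CAutomaton (P M : Set) : Set where
  field
    fsa           : FSA P M
    deterministic : Deterministic fsa
open CAutomaton public

data Path {P M : Set} (A : FSA P M) : Fin (n A) → List (Interaction P M) → Fin (n A) → Set where
  done : ∀ {q} → Path A q [] q
  step : ∀ {q α q' w q''} → (q , α , q') ∈ trans A → Path A q' w q'' → Path A q (α ∷ w) q''

-- finite words of the language L(A) (all states accepting)
data Lang {P M : Set} (A : CAutomaton P M) (w : List (Interaction P M)) : Set where
  accepted : ∀ {q} → Path (fsa A) (q₀ (fsa A)) w q → Lang A w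

{-# OPTIONS --safe #-}
-- CUI fails exactly when some w₁ α, w₂ α, w are accepted, w looks like w₁ to the
-- sender of α and like w₂ to its receiver, yet w α is rejected. By determinism only
-- the states reached by w, w₁ and w₂ matter, and these triples are the reachable
-- states of a finite product automaton running three copies of the automaton, kept
-- in step on the letters visible to the sender resp. the receiver. CUI is thus the
-- decidable condition that at every reachable triple, α enabled in the second and
-- third components is enabled in the first.
module Submission where

open import Defs
open import Relation.Nullary using (Dec)
open import Relation.Binary.Definitions using (DecidableEquality)

open import Data.Bool using (Bool; true; false; if_then_else_) renaming (_≟_ to _≟B_)
open import Data.Empty using (⊥-elim)
open import Data.Fin using (Fin) renaming (_≟_ to _≟F_)
open import Data.Fin.Properties using (any?; all?)
open import Data.List using (List; []; _∷_; _++_; [_]; allFin; cartesianProduct)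
open import Data.List.Properties using (∷-injective; ++-conicalˡ; ++-conicalʳ)
open import Data.List.Membership.Propositional using (_∈_)
open import Data.List.Membership.Propositional.Properties using (∈-allFin; ∈-cartesianProduct⁺)
open import Data.List.Relation.Unary.Any as Any using (Any; here; there; satisfied)
open import Data.List.Relation.Unary.All as All using (All)
open import Data.Product using (∃; _×_; _,_)
open import Data.Product.Properties using (≡-dec)
open import Data.Sum using (_⊎_; inj₁; inj₂; [_,_]′)
open import Relation.Binary.Construct.Closure.ReflexiveTransitive using (Star; ε; _◅_; _◅◅_)
open import Relation.Nullary using (¬_; yes; no)
open import Relation.Nullary.Decidable using (map′; _×-dec_; _⊎-dec_; _→-dec_)
open import Relation.Binary.PropositionalEquality using (_≡_; _≢_; refl; sym; cong) renaming (trans to ≡-trans)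

∃-Bool? : {B : Bool → Set} → (∀ m → Dec (B m)) → Dec (∃ B)
∃-Bool? B? = map′ [ (false ,_) , (true ,_) ]′ from (B? false ⊎-dec B? true)
  where
  from : ∃ _ → _
  from (false , b) = inj₁ b
  from (true  , b) = inj₂ b

-- Floyd–Warshall: a path whose intermediate vertices lie in v ∷ V either avoids v
-- or splits at v into two paths with intermediate vertices in V.
module FiniteReachability {X : Set} (_≟_ : DecidableEquality X)
         (E : X → X → Set) (E? : ∀ x y → Dec (E x y))
         (vertices : List X) (complete : ∀ x → x ∈ vertices) where

  data Via (V : List X) : X → X → Set where
    edge : ∀ {x y} → E x y → Via V x y
    hop  : ∀ {x z y} → E x z → z ∈ V → Via V z y → Via V x y

  via-weaken : ∀ {v V x y} → Via V x y → Via (v ∷ V) x y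
  via-weaken (edge e)    = edge e
  via-weaken (hop e z p) = hop e (there z) (via-weaken p)

  via-join : ∀ {V x z y} → Via V x z → z ∈ V → Via V z y → Via V x y
  via-join (edge e)     z q = hop e z q
  via-join (hop e z' p) z q = hop e z' (via-join p z q)

  via-split : ∀ {v V x y} → Via (v ∷ V) x y → Via V x y ⊎ (Via V x v × Via V v y)
  via-split (edge e) = inj₁ (edge e)
  via-split {v} (hop {z = z} e z∈ p) with z ≟ v | via-split p | z∈
  ... | yes refl | inj₁ q       | _        = inj₂ (edge e , q)
  ... | yes refl | inj₂ (_ , q) | _        = inj₂ (edge e , q)
  ... | no z≢v   | _            | here z≡v = ⊥-elim (z≢v z≡v)
  ... | no _     | inj₁ q       | there z' = inj₁ (hop e z' q)
  ... | no _     | inj₂ (q , r) | there z' = inj₂ (hop e z' q , r)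

  via? : ∀ V x y → Dec (Via V x y)
  via? [] x y = map′ edge from (E? x y)
    where
    from : Via [] x y → E x y
    from (edge e) = e
  via? (v ∷ V) x y =
    map′ [ via-weaken , (λ (p , q) → via-join (via-weaken p) (here refl) (via-weaken q)) ]′
         via-split (via? V x y ⊎-dec (via? V x v ×-dec via? V v y))

  star⇒via : ∀ {x y} → Star E x y → x ≡ y ⊎ Via vertices x y
  star⇒via ε = inj₁ refl
  star⇒via (e ◅ s) with star⇒via s
  ... | inj₁ refl = inj₂ (edge e)
  ... | inj₂ p    = inj₂ (hop e (complete _) p)

  via⇒star : ∀ {V x y} → Via V x y → Star E x y
  via⇒star (edge e)    = e ◅ ε
  via⇒star (hop e _ p) = e ◅ via⇒star p

  star? : ∀ x y → Dec (Star E x y)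
  star? x y = map′ [ (λ { refl → ε }) , via⇒star ]′ star⇒via (x ≟ y ⊎-dec via? vertices x y)

module _ {P M : Set} {F : FSA P M} where

  path-deterministic : Deterministic F → ∀ {q w r r'} → Path F q w r → Path F q w r' → r ≡ r'
  path-deterministic det done       done         = refl
  path-deterministic det (step t p) (step t' p') with det t t'
  ... | refl = path-deterministic det p p'

  path-++⁺ : ∀ {q u s v r} → Path F q u s → Path F s v r → Path F q (u ++ v) r
  path-++⁺ done       p' = p'
  path-++⁺ (step t p) p' = step t (path-++⁺ p p')

  path-++⁻ : ∀ {q v r} u → Path F q (u ++ v) r → ∃ λ s → Path F q u s × Path F s v r
  path-++⁻ []      p          = _ , done , p
  path-++⁻ (_ ∷ u) (step t p) with path-++⁻ u p
  ... | s , p₁ , p₂ = s , step t p₁ , p₂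

module Projections {P M : Set} (_≟P_ : DecidableEquality P) (_≟M_ : DecidableEquality M) where

  content : Interaction P M → P × P × M
  content α = sender α , receiver α , msg α

  content-injective : ∀ {α β : Interaction P M} → content α ≡ content β → α ≡ β
  content-injective {_ ⟶ _ ∶ _ ⟨ _ ⟩} {_ ⟶ _ ∶ _ ⟨ _ ⟩} refl = refl

  _≟I_ : DecidableEquality (Interaction P M)
  α ≟I β = map′ content-injective (cong content) (content α ≟C content β)
    where _≟C_ = ≡-dec _≟P_ (≡-dec _≟P_ _≟M_)

  actionContent : Action P M → P × P × M
  actionContent (send s r m) = s , r , m
  actionContent (recv s r m) = s , r , m

  Silent : P → Interaction P M → Set
  Silent c β = projI _≟P_ c β ≡ []

  silent? : ∀ c β → Dec (Silent c β)
  silent? c β with projI _≟P_ c β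
  ... | []    = yes refl
  ... | _ ∷ _ = no λ ()

  projI-visible : ∀ c β → ¬ Silent c β →
                  ∃ λ x → projI _≟P_ c β ≡ [ x ] × actionContent x ≡ content β
  projI-visible c β ¬silent with sender β ≟P c
  ... | yes _ = _ , refl , refl
  ... | no _ with receiver β ≟P c
  ...   | yes _ = _ , refl , refl
  ...   | no _  = ⊥-elim (¬silent refl)

  visible-++-injective : ∀ {c β γ u v} → ¬ Silent c β → ¬ Silent c γ →
                         projI _≟P_ c β ++ u ≡ projI _≟P_ c γ ++ v → β ≡ γ × u ≡ v
  visible-++-injective {c} {β} {γ} {u} {v} ¬sβ ¬sγ e
    with projI-visible c β ¬sβ | projI-visible c γ ¬sγ
  ... | _ , pβ , cβ | _ , pγ , cγ
    with ∷-injective (≡-trans (sym (cong (_++ u) pβ)) (≡-trans e (cong (_++ v) pγ)))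
  ... | refl , u≡v = content-injective (≡-trans (sym cβ) cγ) , u≡v

  visible-++-nonempty : ∀ {c β u} → ¬ Silent c β → projI _≟P_ c β ++ u ≢ []
  visible-++-nonempty {c} {β} {u} ¬s e with projI-visible c β ¬s
  ... | _ , pβ , _ with ≡-trans (sym (cong (_++ u) pβ)) e
  ... | ()

module CUICriterion {P M : Set} (_≟P_ : DecidableEquality P) (_≟M_ : DecidableEquality M)
         (A : CAutomaton P M) where

  open Projections _≟P_ _≟M_

  private
    I   = Interaction P M
    St  = Fin (n (fsa A))
    T   = trans (fsa A)
    pr  = proj {P} {M} _≟P_
    Triple = St × St × St

  label : St × I × St → I
  label (_ , α , _) = α

  _∈T? : ∀ t → Dec (t ∈ T)
  t ∈T? = Any.any? (≡-dec _≟F_ (≡-dec _≟I_ _≟F_) t) T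

  Enabled : St → I → Set
  Enabled q α = ∃ λ q' → (q , α , q') ∈ T

  enabled? : ∀ q α → Dec (Enabled q α)
  enabled? q α = any? λ q' → (q , α , q') ∈T?

  Move : Bool → St → I → St → Set
  Move true  q β q' = (q , β , q') ∈ T
  Move false q β q' = q ≡ q'

  move? : ∀ m q β q' → Dec (Move m q β q')
  move? true  q β q' = (q , β , q') ∈T?
  move? false q β q' = q ≟F q'

  move-path : ∀ {m q β q' w r} → Move m q β q' → Path (fsa A) q' w r →
              Path (fsa A) q (if m then β ∷ w else w) r
  move-path {true}  t    p = step t p
  move-path {false} refl p = p

  Synced : P → I → Bool → Bool → Set
  Synced c β m m' = Silent c β ⊎ m ≡ m'

  silent-prepend : ∀ {c β} → Silent c β → ∀ m w → pr c (if m then β ∷ w else w) ≡ pr c w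
  silent-prepend {c} s true  w = cong (_++ pr c w) s
  silent-prepend s false w = refl

  synced-proj : ∀ {c β m m' w w'} → Synced c β m m' → pr c w ≡ pr c w' →
                pr c (if m then β ∷ w else w) ≡ pr c (if m' then β ∷ w' else w')
  synced-proj {m = m} {m'} {w} {w'} (inj₁ s) e =
    ≡-trans (silent-prepend s m w) (≡-trans e (sym (silent-prepend s m' w')))
  synced-proj {c} {β} {true}  (inj₂ refl) e = cong (projI _≟P_ c β ++_) e
  synced-proj {m = false} (inj₂ refl) e = e

  -- A run on w₁ with pr c w₁ ≡ projI c β ++ rest reaches its first c-visible letter,
  -- which is β, after a c-silent prefix; if β is silent for c, nothing is consumed.
  data NextOccurrence (c : P) (β : I) (q₁ r₁ : St) (rest : List (Action P M)) : Set where
    occurrence : ∀ {u v s s'} m → Path (fsa A) q₁ u s → pr c u ≡ [] → Move m s β s' →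
                 Synced c β true m → Path (fsa A) s' v r₁ → pr c v ≡ rest →
                 NextOccurrence c β q₁ r₁ rest

  next-visible-occurrence : ∀ {c β q₁ w₁ r₁ rest} → ¬ Silent c β → Path (fsa A) q₁ w₁ r₁ →
                            pr c w₁ ≡ projI _≟P_ c β ++ rest → NextOccurrence c β q₁ r₁ rest
  next-visible-occurrence ¬s done e = ⊥-elim (visible-++-nonempty ¬s (sym e))
  next-visible-occurrence {c} ¬s (step {α = γ} {w = w} t p) e with silent? c γ
  ... | no ¬sγ with visible-++-injective ¬sγ ¬s e
  ...   | refl , e' = occurrence true done refl t (inj₂ refl) p e'
  next-visible-occurrence {c} ¬s (step {α = γ} {w = w} t p) e | yes sγ
    with next-visible-occurrence ¬s p (≡-trans (sym (cong (_++ pr c w) sγ)) e)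
  ... | occurrence m u u-silent mv sync v e' =
    occurrence m (step t u) (≡-trans (cong (_++ _) sγ) u-silent) mv sync v e'

  next-occurrence : ∀ c β {q₁ w₁ r₁ rest} → Path (fsa A) q₁ w₁ r₁ →
                    pr c w₁ ≡ projI _≟P_ c β ++ rest → NextOccurrence c β q₁ r₁ rest
  next-occurrence c β {rest = rest} p e with silent? c β
  ... | yes s = occurrence false done refl refl (inj₁ s) p (≡-trans e (cong (_++ rest) s))
  ... | no ¬s = next-visible-occurrence ¬s p e

  -- A triple (q , q₁ , q₂) tracks runs on words w , w₁ , w₂ such that a cannot
  -- tell w from w₁ and b cannot tell w from w₂.
  module UnknownInformationProduct (a b : P) where

    StepBy : I → Triple → Triple → Set
    StepBy β (q , q₁ , q₂) (q' , q₁' , q₂') = ∃ λ m → ∃ λ m₁ → ∃ λ m₂ →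
      Move m q β q' × Move m₁ q₁ β q₁' × Move m₂ q₂ β q₂' × Synced a β m m₁ × Synced b β m m₂

    stepBy? : ∀ β x y → Dec (StepBy β x y)
    stepBy? β (q , q₁ , q₂) (q' , q₁' , q₂') =
      ∃-Bool? λ m → ∃-Bool? λ m₁ → ∃-Bool? λ m₂ →
        move? m q β q' ×-dec move? m₁ q₁ β q₁' ×-dec move? m₂ q₂ β q₂' ×-dec
        (silent? a β ⊎-dec (m ≟B m₁)) ×-dec (silent? b β ⊎-dec (m ≟B m₂))

    Step : Triple → Triple → Set
    Step x y = Any (λ t → StepBy (label t) x y) T

    step-by : ∀ {p β p' x y} → (p , β , p') ∈ T → StepBy β x y → Step x y
    step-by t s = Any.map (λ { refl → s }) t

    triples : List Triple
    triples = cartesianProduct (allFin _) (cartesianProduct (allFin _) (allFin _))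

    ∈-triples : ∀ x → x ∈ triples
    ∈-triples (q , q₁ , q₂) =
      ∈-cartesianProduct⁺ (∈-allFin q) (∈-cartesianProduct⁺ (∈-allFin q₁) (∈-allFin q₂))

    open FiniteReachability (≡-dec _≟F_ (≡-dec _≟F_ _≟F_)) Step
      (λ x y → Any.any? (λ t → stepBy? (label t) x y) T) triples ∈-triples
      using (star?) public

    data Synchronised : Triple → Triple → Set where
      synchronised : ∀ {q q₁ q₂ r r₁ r₂ w w₁ w₂} →
        Path (fsa A) q w r → Path (fsa A) q₁ w₁ r₁ → Path (fsa A) q₂ w₂ r₂ →
        pr a w ≡ pr a w₁ → pr b w ≡ pr b w₂ → Synchronised (q , q₁ , q₂) (r , r₁ , r₂)

    star⇒synchronised : ∀ {x y} → Star Step x y → Synchronised x y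
    star⇒synchronised {_ , _ , _} ε = synchronised done done done refl refl
    star⇒synchronised (s ◅ s*) with satisfied s | star⇒synchronised s*
    ... | _ , (_ , _ , _ , mv , mv₁ , mv₂ , sa , sb) | synchronised p p₁ p₂ e₁ e₂ =
      synchronised (move-path mv p) (move-path mv₁ p₁) (move-path mv₂ p₂)
                   (synced-proj sa e₁) (synced-proj sb e₂)

    silent-run₁ : ∀ {q q₁ q₂ u r₁} → Path (fsa A) q₁ u r₁ → pr a u ≡ [] →
                  Star Step (q , q₁ , q₂) (q , r₁ , q₂)
    silent-run₁ done       e = ε
    silent-run₁ (step t p) e =
      step-by t (false , true , false , refl , t , refl , inj₁ (++-conicalˡ _ _ e) , inj₂ refl)
      ◅ silent-run₁ p (++-conicalʳ _ _ e)

    silent-run₂ : ∀ {q q₁ q₂ u r₂} → Path (fsa A) q₂ u r₂ → pr b u ≡ [] →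
                  Star Step (q , q₁ , q₂) (q , q₁ , r₂)
    silent-run₂ done       e = ε
    silent-run₂ (step t p) e =
      step-by t (false , false , true , refl , refl , t , inj₂ refl , inj₁ (++-conicalˡ _ _ e))
      ◅ silent-run₂ p (++-conicalʳ _ _ e)

    synchronised⇒star : ∀ {x y} → Synchronised x y → Star Step x y
    synchronised⇒star (synchronised p p₁ p₂ e₁ e₂) = go p p₁ p₂ e₁ e₂
      where
      go : ∀ {q q₁ q₂ r r₁ r₂ w w₁ w₂} →
           Path (fsa A) q w r → Path (fsa A) q₁ w₁ r₁ → Path (fsa A) q₂ w₂ r₂ →
           pr a w ≡ pr a w₁ → pr b w ≡ pr b w₂ → Star Step (q , q₁ , q₂) (r , r₁ , r₂)
      go done p₁ p₂ e₁ e₂ = silent-run₁ p₁ (sym e₁) ◅◅ silent-run₂ p₂ (sym e₂)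
      go (step {α = β} t p) p₁ p₂ e₁ e₂
        with next-occurrence a β p₁ (sym e₁) | next-occurrence b β p₂ (sym e₂)
      ... | occurrence m₁ u₁ s₁ mv₁ sa v₁ e₁' | occurrence m₂ u₂ s₂ mv₂ sb v₂ e₂' =
        silent-run₁ u₁ s₁ ◅◅ silent-run₂ u₂ s₂ ◅◅
        step-by t (true , m₁ , m₂ , t , mv₁ , mv₂ , sa , sb) ◅ go p v₁ v₂ (sym e₁') (sym e₂')

  open UnknownInformationProduct using (Step; star?; synchronised; star⇒synchronised; synchronised⇒star)

  Reachable : P → P → Triple → Set
  Reachable a b = Star (Step a b) (q₀ (fsa A) , q₀ (fsa A) , q₀ (fsa A))

  ClosedAt : I → St → St → St → Set
  ClosedAt α q q₁ q₂ =
    Reachable (sender α) (receiver α) (q , q₁ , q₂) → Enabled q₁ α → Enabled q₂ α → Enabled q α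

  closedAt? : ∀ α q q₁ q₂ → Dec (ClosedAt α q q₁ q₂)
  closedAt? α q q₁ q₂ =
    star? (sender α) (receiver α) _ _ →-dec (enabled? q₁ α →-dec (enabled? q₂ α →-dec enabled? q α))

  -- Only labels of transitions need checking: CUI constrains α only when w₁ α is accepted.
  Criterion : Set
  Criterion = All (λ t → ∀ q q₁ q₂ → ClosedAt (label t) q q₁ q₂) T

  criterion? : Dec Criterion
  criterion? = All.all? (λ t → all? λ q → all? λ q₁ → all? λ q₂ → closedAt? (label t) q q₁ q₂) T

  cui⇒criterion : CUI _≟P_ (Lang A) → Criterion
  cui⇒criterion cui = All.tabulate λ { {_ , α , _} _ _ _ _ → closedAt α }
    where
    closedAt : ∀ α {q q₁ q₂} → ClosedAt α q q₁ q₂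
    closedAt α reach (_ , t₁) (_ , t₂)
      with star⇒synchronised (sender α) (receiver α) reach
    ... | synchronised {w = w} p p₁ p₂ e₁ e₂
      with cui _ _ w α (accepted (path-++⁺ p₁ (step t₁ done))) (accepted (path-++⁺ p₂ (step t₂ done)))
               (accepted p) e₁ e₂
    ... | accepted p' with path-++⁻ w p'
    ... | _ , p'' , step t done with path-deterministic (deterministic A) p p''
    ... | refl = _ , t

  criterion⇒cui : Criterion → CUI _≟P_ (Lang A)
  criterion⇒cui criterion w₁ w₂ w α (accepted p₁') (accepted p₂') (accepted p) e₁ e₂
    with path-++⁻ w₁ p₁' | path-++⁻ w₂ p₂'
  ... | r₁ , p₁ , step t₁ done | r₂ , p₂ , step t₂ done
    with All.lookup criterion t₁ _ r₁ r₂
           (synchronised⇒star (sender α) (receiver α) (synchronised p p₁ p₂ e₁ e₂)) (_ , t₁) (_ , t₂)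
  ... | _ , t = accepted (path-++⁺ p (step t done))

theorem7p5 : {P M : Set} (_≟P_ : DecidableEquality P) (_≟M_ : DecidableEquality M) →
    (A : CAutomaton P M) → Dec (CUI _≟P_ (Lang A))
theorem7p5 _≟P_ _≟M_ A = map′ criterion⇒cui cui⇒criterion criterion?
  where open CUICriterion _≟P_ _≟M_ A
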